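{- Let $p$ be a program of the split fireball calculus and let $\pi \triangleright \Gamma \vdash p : M$ be a type derivation. Then there exist a normal program $q$ and an evaluation $d : p \to_{\beta_f}^* q$ such that $|d| + |q| \leq |\pi|$.
   Context: Terms: $t,u ::= x \mid \lambda x.t \mid tu$, up to $\alpha$-equivalence; $t\{x\leftarrow u\}$ is capture-avoiding substitution. Values: $v ::= x \mid \lambda x.t$. Fireballs $f$ and inert terms $i$ are defined by mutual induction: $f ::= v \mid i$ and $i ::= x f_1 \dots f_n$ with $n>0$ (application left-associative). Right evaluation contexts: $C ::= \langle\cdot\rangle \mid t\,C \mid C\,f$. Split fireball calculus: environments $E ::= \epsilon \mid [x\leftarrow i]:E$ (lists of pairs of a variable and an inert term); programs are pairs $p=(t,E)$. Reduction on programs: $(C\langle(\lambda x.t)v\rangle,E)\to_{\beta_v}(C\langle t\{x\leftarrow v\}\rangle,E)$ and $(C\langle(\lambda x.t)i\rangle,E)\to_{\beta_i}(C\langle t\rangle,[x\leftarrow i]:E)$; $\to_{\beta_f}=\to_{\beta_v}\cup\to_{\beta_i}$. A program is normal if it has no $\to_{\beta_f}$-reduct. For an evaluation $d$, $|d|$ is its number of $\to_{\beta_f}$-steps. Append: $\epsilon@[x\leftarrow i]=[x\leftarrow i]$, $([y\leftarrow i']:E)@[x\leftarrow i]=[y\leftarrow i']:(E@[x\leftarrow i])$. Sizes: $|v|=0$, $|tu|=|t|+|u|+1$, $|(t,\epsilon)|=|t|$, $|(t,E@[x\leftarrow i])|=|(t,E)|+|i|$. Multi types: linear types $L ::= M\multimap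 N$; multi types $M,N ::= [L_1,\dots,L_n]$ (finite multisets, $n\ge 0$); $\mathbf 0$ is the empty multiset and $\uplus$ is multiset sum. A type context $\Gamma$ is a total map from variables to multi types with finite $\mathrm{dom}(\Gamma)=\{x\mid \Gamma(x)\ne\mathbf 0\}$; $(\Gamma\uplus\Delta)(x)=\Gamma(x)\uplus\Delta(x)$; $x:M$ is the context mapping $x$ to $M$ and all else to $\mathbf 0$; $\Gamma,x:M$ extends $\Gamma$ (with $x\notin\mathrm{dom}(\Gamma)$) by $x\mapsto M$. Typing rules: (ax) $x:M\vdash x:M$; (@) from $\Gamma\vdash t:[M\multimap N]$ and $\Delta\vdash u:M$ infer $\Gamma\uplus\Delta\vdash tu:N$; ($\lambda$) from $\Gamma_k,x:M_k\vdash t:N_k$ for $k=1,\dots,n$ ($n\ge0$) infer $\Gamma_1\uplus\dots\uplus\Gamma_n\vdash\lambda x.t:[M_1\multimap N_1,\dots,M_n\multimap N_n]$; (es$_\epsilon$) from $\Gamma\vdash t:M$ infer $\Gamma\vdash (t,\epsilon):M$; (es$_@$) from $\Gamma,x:M\vdash(t,E):N$ and $\Delta\vdash i:M$ infer $\Gamma\uplus\Delta\vdash(t,E@[x\leftarrow i]):N$. $\pi\triangleright\Gamma\vdash e:M$ means $\pi$ is a derivation with that conclusion; $|\pi|$ is the number of (@) rules in $\pi$. -}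

module Defs where

open import Data.Nat using (ℕ; zero; suc; _+_)
open import Data.Fin using (Fin; zero; suc)
open import Data.List using (List; []; _∷_; _++_)
open import Data.Vec using (Vec; []; _∷_; replicate; zipWith; _[_]≔_)
open import Data.Vec.Relation.Binary.Pointwise.Inductive using (Pointwise)
open import Data.Product using (Σ; _×_; _,_)
open import Relation.Nullary using (¬_)

data Term (n : ℕ) : Set where
  var : Fin n → Term n
  lam : Term (suc n) → Term n
  app : Term n → Term n → Term n

Ren : ℕ → ℕ → Set
Ren n m = Fin n → Fin m

ext : ∀ {n m} → Ren n m → Ren (suc n) (suc m)
ext ρ zero    = zero
ext ρ (suc x) = suc (ρ x)

rename : ∀ {n m} → Ren n m → Term n → Term m
rename ρ (var x)   = var (ρ x)
rename ρ (lam t)   = lam (rename (ext ρ) t)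
rename ρ (app t u) = app (rename ρ t) (rename ρ u)

Sub : ℕ → ℕ → Set
Sub n m = Fin n → Term m

exts : ∀ {n m} → Sub n m → Sub (suc n) (suc m)
exts σ zero    = var zero
exts σ (suc x) = rename suc (σ x)

subst : ∀ {n m} → Sub n m → Term n → Term m
subst σ (var x)   = σ x
subst σ (lam t)   = lam (subst (exts σ) t)
subst σ (app t u) = app (subst σ t) (subst σ u)

_[_] : ∀ {n} → Term (suc n) → Term n → Term n
t [ u ] = subst σ t
  where
  σ : Sub _ _
  σ zero    = u
  σ (suc x) = var x

data Value {n : ℕ} : Term n → Set where
  v-var : (x : Fin n) → Value (var x)
  v-lam : (t : Term (suc n)) → Value (lam t)

mutual
  data Fireball {n : ℕ} : Term n → Set where
    f-val   : ∀ {t} → Value t → Fireball t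
    f-inert : ∀ {t} → Inert t → Fireball t

  data Inert {n : ℕ} : Term n → Set where
    i-var : ∀ (x : Fin n) {f} → Fireball f → Inert (app (var x) f)
    i-app : ∀ {i f} → Inert i → Fireball f → Inert (app i f)

data ECtx (n : ℕ) : Set where
  hole : ECtx n
  appR : Term n → ECtx n → ECtx n
  appL : ECtx n → Term n → ECtx n

data IsRCtx {n : ℕ} : ECtx n → Set where
  rc-hole : IsRCtx hole
  rc-appR : ∀ t {C} → IsRCtx C → IsRCtx (appR t C)
  rc-appL : ∀ {C f} → IsRCtx C → Fireball f → IsRCtx (appL C f)

plug : ∀ {n} → ECtx n → Term n → Term n
plug hole       s = s
plug (appR t C) s = app t (plug C s)
plug (appL C f) s = app (plug C s) f

wkCtx : ∀ {n} → ECtx n → ECtx (suc n)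
wkCtx hole       = hole
wkCtx (appR t C) = appR (rename suc t) (wkCtx C)
wkCtx (appL C f) = appL (wkCtx C) (rename suc f)

-- Env n k: an environment over n free (outer) variables
-- which binds variables so that the term of the program lives in scope k.
-- The constructor is the append  E @ [x ← i]  (the last entry is the
-- outermost binder: i lives in scope n, E lives in scope suc n, x = zero).

data Env (n : ℕ) : ℕ → Set where
  ε    : Env n n
  _◂[_∣_] : ∀ {k} → Env (suc n) k → (i : Term n) → Inert i → Env n k

-- [x ← i] : E   (the new entry is the innermost binder)
_∷ₑ_∣_ : ∀ {n k} → (i : Term k) → Env n k → Inert i → Env n (suc k)
i ∷ₑ ε ∣ ii = ε ◂[ i ∣ ii ]
i ∷ₑ (E ◂[ j ∣ jj ]) ∣ ii = (i ∷ₑ E ∣ ii) ◂[ j ∣ jj ]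

record Prog (n : ℕ) : Set where
  constructor ⟨_,_⟩
  field
    {scope} : ℕ
    tm  : Term scope
    env : Env n scope

data _⟶βf_ {n : ℕ} : Prog n → Prog n → Set where
  βv : ∀ {k} {C : ECtx k} {t : Term (suc k)} {v : Term k} {E : Env n k} →
       IsRCtx C → Value v →
       ⟨ plug C (app (lam t) v) , E ⟩ ⟶βf ⟨ plug C (t [ v ]) , E ⟩
  βi : ∀ {k} {C : ECtx k} {t : Term (suc k)} {i : Term k} {E : Env n k} →
       IsRCtx C → (ii : Inert i) →
       ⟨ plug C (app (lam t) i) , E ⟩ ⟶βf ⟨ plug (wkCtx C) t , i ∷ₑ E ∣ ii ⟩

Normal : ∀ {n} → Prog n → Set
Normal p = ¬ (Σ _ λ q → p ⟶βf q)

data _⟶*_ {n : ℕ} : Prog n → Prog n → Set where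
  done : ∀ {p} → p ⟶* p
  step : ∀ {p q r} → p ⟶βf q → q ⟶* r → p ⟶* r

len : ∀ {n} {p q : Prog n} → p ⟶* q → ℕ
len done       = 0
len (step _ d) = suc (len d)

size : ∀ {n} → Term n → ℕ
size (var _)   = 0
size (lam _)   = 0
size (app t u) = size t + size u + 1

sizeP : ∀ {n k} → Term k → Env n k → ℕ
sizeP t ε               = size t
sizeP t (E ◂[ i ∣ _ ])  = sizeP t E + size i

sizeProg : ∀ {n} → Prog n → ℕ
sizeProg ⟨ t , E ⟩ = sizeP t E

-- Multi types.  Multisets are represented by lists, identified up to the
-- (deep) multiset equivalence ≈M defined below.

data LType : Set where
  _⊸_ : List LType → List LType → LType

MType : Set
MType = List LType

𝟎 : MType
𝟎 = []

_⊎_ : MType → MType → MType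
_⊎_ = _++_

data Del (y : LType) : MType → MType → Set where
  here  : ∀ {ys} → Del y (y ∷ ys) ys
  there : ∀ {w ys zs} → Del y ys zs → Del y (w ∷ ys) (w ∷ zs)

mutual
  data _≈L_ : LType → LType → Set where
    ⊸-cong : ∀ {M M' N N'} → M ≈M M' → N ≈M N' → (M ⊸ N) ≈L (M' ⊸ N')

  data _≈M_ : MType → MType → Set where
    []  : [] ≈M []
    _∷_ : ∀ {x y xs ys zs} → x ≈L y → Del y ys zs → xs ≈M zs → (x ∷ xs) ≈M ys

TyCtx : ℕ → Set
TyCtx n = Vec MType n

_≈Γ_ : ∀ {n} → TyCtx n → TyCtx n → Set
_≈Γ_ = Pointwise _≈M_

𝟎Γ : ∀ {n} → TyCtx n
𝟎Γ = replicate _ 𝟎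

_⊎Γ_ : ∀ {n} → TyCtx n → TyCtx n → TyCtx n
_⊎Γ_ = zipWith _⊎_

_∶∶_ : ∀ {n} → Fin n → MType → TyCtx n
x ∶∶ M = 𝟎Γ [ x ]≔ M

-- Typing derivations.  Every rule concludes its context and type up to
-- multiset equivalence (this is how multisets-as-lists are quotiented).

mutual
  data _⊢_∶_ {n : ℕ} : TyCtx n → Term n → MType → Set where
    ax  : ∀ {Θ T} (x : Fin n) (M : MType) →
          Θ ≈Γ (x ∶∶ M) → T ≈M M → Θ ⊢ var x ∶ T
    app : ∀ {Θ T Γ Δ t u M N} →
          Γ ⊢ t ∶ ((M ⊸ N) ∷ []) → Δ ⊢ u ∶ M →
          Θ ≈Γ (Γ ⊎Γ Δ) → T ≈M N → Θ ⊢ app t u ∶ T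
    lam : ∀ {Θ T Γ A t} →
          LamPremises t Γ A →
          Θ ≈Γ Γ → T ≈M A → Θ ⊢ lam t ∶ T

  -- the n ≥ 0 premises  Γₖ , x : Mₖ ⊢ t : Nₖ  of rule (λ), with
  -- accumulated context Γ₁ ⊎ … ⊎ Γₙ and type [M₁ ⊸ N₁, …, Mₙ ⊸ Nₙ]
  data LamPremises {n : ℕ} (t : Term (suc n)) : TyCtx n → MType → Set where
    none : LamPremises t 𝟎Γ []
    more : ∀ {Γ M N Δ A} →
           (M ∷ Γ) ⊢ t ∶ N → LamPremises t Δ A →
           LamPremises t (Γ ⊎Γ Δ) ((M ⊸ N) ∷ A)

data _⊢P_,_∶_ {n : ℕ} : TyCtx n → ∀ {k} → Term k → Env n k → MType → Set where
  es-ε : ∀ {Θ T Γ M} {t : Term n} →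
         Γ ⊢ t ∶ M → Θ ≈Γ Γ → T ≈M M → Θ ⊢P t , ε ∶ T
  es-snoc : ∀ {Θ T Γ Δ M N k} {t : Term k} {E : Env (suc n) k} {i : Term n} →
         (M ∷ Γ) ⊢P t , E ∶ N → Δ ⊢ i ∶ M → (ii : Inert i) →
         Θ ≈Γ (Γ ⊎Γ Δ) → T ≈M N → Θ ⊢P t , E ◂[ i ∣ ii ] ∶ T

_⊢Prog_∶_ : ∀ {n} → TyCtx n → Prog n → MType → Set
Γ ⊢Prog ⟨ t , E ⟩ ∶ M = Γ ⊢P t , E ∶ M

mutual
  sizeD : ∀ {n Γ} {t : Term n} {M} → Γ ⊢ t ∶ M → ℕ
  sizeD (ax _ _ _ _)       = 0
  sizeD (app π σ _ _)      = suc (sizeD π + sizeD σ)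
  sizeD (lam ps _ _)       = sizeL ps

  sizeL : ∀ {n} {t : Term (suc n)} {Γ A} → LamPremises t Γ A → ℕ
  sizeL none        = 0
  sizeL (more π ps) = sizeD π + sizeL ps

sizePD : ∀ {n Γ k} {t : Term k} {E : Env n k} {M} → Γ ⊢P t , E ∶ M → ℕ
sizePD (es-ε π _ _)       = sizeD π
sizePD (es-snoc π σ _ _ _)   = sizePD π + sizeD σ

sizeProgD : ∀ {n Γ} {p : Prog n} {M} → Γ ⊢Prog p ∶ M → ℕ
sizeProgD {p = ⟨ t , E ⟩} π = sizePD π

module Submission where

-- Multi types are quantitative: a derivation of a value can be split among the copies of that
-- value a substitution creates, so typing is preserved by β_v (substitution) and β_i (a new
-- environment entry) while at least the (@) rule of the contracted redex disappears.  Hence every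
-- step strictly decreases |π|, evaluation stops after at most |π| steps, and it stops on a
-- fireball, whose program size is bounded by the (@) rules still in the final derivation.

open import Defs
open import Level using (0ℓ)
open import Algebra.Bundles using (CommutativeMonoid)
import Algebra.Properties.CommutativeSemigroup as CommutativeSemigroupProperties
open import Data.Nat using (ℕ; suc; _+_; _≤_; _<_; z≤n; s≤s)
open import Data.Nat.Properties using (≤-refl; ≤-trans; ≤-reflexive; +-suc; module ≤-Reasoning; +-monoˡ-<; +-monoʳ-<; +-comm; +-assoc; +-identityʳ; +-mono-≤; +-monoʳ-≤; +-commutativeSemigroup)
open import Data.Fin using (Fin; zero; suc; punchIn; punchOut)
open import Data.Fin.Properties using (_≟_; punchInᵢ≢i; punchIn-punchOut)
open import Function using (_∘_)
open import Data.List using ([]; _∷_; _++_)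
open import Data.List.Properties using (++-assoc; ++-identityʳ)
open import Data.Vec using ([]; _∷_; lookup; insertAt; removeAt)
open import Data.Vec.Properties using (lookup∘update; lookup∘update′; lookup-replicate; lookup-zipWith)
open import Data.Vec.Relation.Binary.Pointwise.Inductive using ([]; _∷_)
import Data.Vec.Relation.Binary.Pointwise.Inductive as Pointwise
open import Data.Product using (Σ; Σ-syntax; ∃-syntax; _×_; _,_; proj₁)
open import Relation.Binary.PropositionalEquality using (_≡_; _≢_; refl; sym; trans; cong; cong₂) renaming (subst to substEq)
open import Relation.Nullary using (¬_; yes; no)
open import Data.Sum using (inj₁; inj₂) renaming (_⊎_ to _⊎ˢ_)

infixr 5 _∷⟨_⟩_
pattern _∷⟨_⟩_ x≈y d xs≈zs = _∷_ x≈y d xs≈zs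

Del-swap : ∀ {a b xs ys zs} → Del a xs ys → Del b ys zs →
           ∃[ ws ] Del b xs ws × Del a ws zs
Del-swap here       d          = _ , there d , here
Del-swap (there d)  here       = _ , here , d
Del-swap (there d₁) (there d₂) with Del-swap d₁ d₂
... | _ , e₁ , e₂ = _ , there e₁ , there e₂

Del-++ʳ : ∀ {y xs zs} ys → Del y xs zs → Del y (xs ++ ys) (zs ++ ys)
Del-++ʳ ys here      = here
Del-++ʳ ys (there d) = there (Del-++ʳ ys d)

Del-middle : ∀ {y} xs ys → Del y (xs ++ y ∷ ys) (xs ++ ys)
Del-middle []       ys = here
Del-middle (x ∷ xs) ys = there (Del-middle xs ys)

mutual
  ≈L-refl : ∀ {x} → x ≈L x
  ≈L-refl {M ⊸ N} = ⊸-cong ≈M-refl ≈M-refl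

  ≈M-refl : ∀ {xs} → xs ≈M xs
  ≈M-refl {[]}     = []
  ≈M-refl {x ∷ xs} = ≈L-refl ∷⟨ here ⟩ ≈M-refl

≈M-reflexive : ∀ {xs ys} → xs ≡ ys → xs ≈M ys
≈M-reflexive refl = ≈M-refl

≈M-insert : ∀ {y x ys zs xs} → Del y ys zs → zs ≈M xs → y ≈L x → ys ≈M (x ∷ xs)
≈M-insert here      zs≈xs               y≈x = y≈x ∷⟨ here ⟩ zs≈xs
≈M-insert (there d) (w≈u ∷⟨ d′ ⟩ zs≈xs) y≈x = w≈u ∷⟨ there d′ ⟩ ≈M-insert d zs≈xs y≈x

mutual
  ≈L-sym : ∀ {x y} → x ≈L y → y ≈L x
  ≈L-sym (⊸-cong M≈M′ N≈N′) = ⊸-cong (≈M-sym M≈M′) (≈M-sym N≈N′)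

  ≈M-sym : ∀ {xs ys} → xs ≈M ys → ys ≈M xs
  ≈M-sym []                 = []
  ≈M-sym (x≈y ∷⟨ d ⟩ xs≈zs) = ≈M-insert d (≈M-sym xs≈zs) (≈L-sym x≈y)

≈M-Del : ∀ {y ys ys′ zs} → ys ≈M zs → Del y ys ys′ →
         ∃[ z ] ∃[ zs′ ] y ≈L z × Del z zs zs′ × ys′ ≈M zs′
≈M-Del (x≈y ∷⟨ d ⟩ xs≈zs) here       = _ , _ , x≈y , d , xs≈zs
≈M-Del (x≈y ∷⟨ d ⟩ xs≈zs) (there d₀) with ≈M-Del xs≈zs d₀
... | z , _ , y≈z , dz , eq with Del-swap d dz
...   | _ , e₁ , e₂ = z , _ , y≈z , e₁ , x≈y ∷⟨ e₂ ⟩ eq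

mutual
  ≈L-trans : ∀ {x y z} → x ≈L y → y ≈L z → x ≈L z
  ≈L-trans (⊸-cong a b) (⊸-cong c d) = ⊸-cong (≈M-trans a c) (≈M-trans b d)

  ≈M-trans : ∀ {xs ys zs} → xs ≈M ys → ys ≈M zs → xs ≈M zs
  ≈M-trans []                 []    = []
  ≈M-trans (x≈y ∷⟨ d ⟩ xs≈ys) ys≈zs with ≈M-Del ys≈zs d
  ... | _ , _ , y≈z , dz , eq = ≈L-trans x≈y y≈z ∷⟨ dz ⟩ ≈M-trans xs≈ys eq

≈M-++-cong : ∀ {xs xs′ ys ys′} → xs ≈M xs′ → ys ≈M ys′ → (xs ++ ys) ≈M (xs′ ++ ys′)
≈M-++-cong             []                  ys≈ys′ = ys≈ys′
≈M-++-cong {ys′ = ys′} (x≈y ∷⟨ d ⟩ xs≈zs) ys≈ys′ = x≈y ∷⟨ Del-++ʳ ys′ d ⟩ ≈M-++-cong xs≈zs ys≈ys′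

≈M-++-comm : ∀ xs ys → (xs ++ ys) ≈M (ys ++ xs)
≈M-++-comm []       ys = ≈M-reflexive (sym (++-identityʳ ys))
≈M-++-comm (x ∷ xs) ys = ≈L-refl ∷⟨ Del-middle ys xs ⟩ ≈M-++-comm xs ys

≈M-[] : ∀ {xs} → xs ≈M [] → xs ≡ []
≈M-[] []          = refl
≈M-[] (_ ∷⟨ () ⟩ _)

MType-commutativeMonoid : CommutativeMonoid 0ℓ 0ℓ
MType-commutativeMonoid = record
  { Carrier = MType
  ; _≈_ = _≈M_
  ; _∙_ = _⊎_
  ; ε   = 𝟎
  ; isCommutativeMonoid = record
    { isMonoid = record
      { isSemigroup = record
        { isMagma = record
          { isEquivalence = record { refl = ≈M-refl ; sym = ≈M-sym ; trans = ≈M-trans }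
          ; ∙-cong = ≈M-++-cong
          }
        ; assoc = λ xs ys zs → ≈M-reflexive (++-assoc xs ys zs)
        }
      ; identity = (λ _ → ≈M-refl) , (λ xs → ≈M-reflexive (++-identityʳ xs))
      }
    ; comm = ≈M-++-comm
    }
  }

module Mul = CommutativeMonoid MType-commutativeMonoid

TyCtx-commutativeMonoid : ℕ → CommutativeMonoid 0ℓ 0ℓ
TyCtx-commutativeMonoid n = record
  { Carrier = TyCtx n
  ; _≈_ = _≈Γ_
  ; _∙_ = _⊎Γ_
  ; ε   = 𝟎Γ
  ; isCommutativeMonoid = record
    { isMonoid = record
      { isSemigroup = record
        { isMagma = record
          { isEquivalence = Pointwise.isEquivalence Mul.isEquivalence n
          ; ∙-cong = Pointwise.zipWith-cong Mul.∙-cong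
          }
        ; assoc = Pointwise.zipWith-assoc Mul.assoc
        }
      ; identity = Pointwise.zipWith-identityˡ Mul.identityˡ , Pointwise.zipWith-identityʳ Mul.identityʳ
      }
    ; comm = Pointwise.zipWith-comm Mul.comm
    }
  }

module Ctx {n} = CommutativeMonoid (TyCtx-commutativeMonoid n)
module Ctxᴾ {n} = CommutativeSemigroupProperties (Ctx.commutativeSemigroup {n})
module ℕᴾ = CommutativeSemigroupProperties +-commutativeSemigroup

∶∶-cong : ∀ {n} (x : Fin n) {M N} → M ≈M N → (x ∶∶ M) ≈Γ (x ∶∶ N)
∶∶-cong {suc n} zero    M≈N = M≈N ∷ Ctx.refl
∶∶-cong {suc n} (suc x) M≈N = Mul.refl ∷ ∶∶-cong x M≈N

∶∶-⊎ : ∀ {n} (x : Fin n) M N → ((x ∶∶ M) ⊎Γ (x ∶∶ N)) ≈Γ (x ∶∶ (M ⊎ N))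
∶∶-⊎ {suc n} zero    M N = Mul.refl ∷ Ctx.identityˡ 𝟎Γ
∶∶-⊎ {suc n} (suc x) M N = Mul.refl ∷ ∶∶-⊎ x M N

∶∶-𝟎 : ∀ {n} (x : Fin n) → x ∶∶ 𝟎 ≡ 𝟎Γ
∶∶-𝟎 {suc n} zero    = refl
∶∶-𝟎 {suc n} (suc x) = cong (𝟎 ∷_) (∶∶-𝟎 x)

removeAt-suc : ∀ {n} M (Γ : TyCtx (suc n)) k → removeAt (M ∷ Γ) (suc k) ≡ M ∷ removeAt Γ k
removeAt-suc M (_ ∷ _) k = refl

removeAt-⊎Γ : ∀ {n} (Γ Δ : TyCtx (suc n)) k → removeAt (Γ ⊎Γ Δ) k ≡ removeAt Γ k ⊎Γ removeAt Δ k
removeAt-⊎Γ (_ ∷ _)         (_ ∷ _)         zero    = refl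
removeAt-⊎Γ (M ∷ Γ@(_ ∷ _)) (N ∷ Δ@(_ ∷ _)) (suc k) = cong (M ⊎ N ∷_) (removeAt-⊎Γ Γ Δ k)

removeAt-cong : ∀ {n} {Γ Δ : TyCtx (suc n)} k → Γ ≈Γ Δ → removeAt Γ k ≈Γ removeAt Δ k
removeAt-cong zero    (_ ∷ Γ≈Δ)           = Γ≈Δ
removeAt-cong (suc k) (M≈N ∷ Γ≈Δ@(_ ∷ _)) = M≈N ∷ removeAt-cong k Γ≈Δ

removeAt-𝟎Γ : ∀ {n} (k : Fin (suc n)) → removeAt 𝟎Γ k ≡ 𝟎Γ
removeAt-𝟎Γ         zero    = refl
removeAt-𝟎Γ {suc n} (suc k) = cong (𝟎 ∷_) (removeAt-𝟎Γ k)

removeAt-∶∶ : ∀ {n} (k : Fin (suc n)) M → removeAt (k ∶∶ M) k ≡ 𝟎Γ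
removeAt-∶∶         zero    M = refl
removeAt-∶∶ {suc n} (suc k) M = trans (removeAt-suc 𝟎 (k ∶∶ M) k) (cong (𝟎 ∷_) (removeAt-∶∶ k M))

removeAt-∶∶-punchIn : ∀ {n} (k : Fin (suc n)) (y : Fin n) M → removeAt (punchIn k y ∶∶ M) k ≡ y ∶∶ M
removeAt-∶∶-punchIn         zero    y       M = refl
removeAt-∶∶-punchIn {suc n} (suc k) zero    M = cong (M ∷_) (removeAt-𝟎Γ k)
removeAt-∶∶-punchIn {suc n} (suc k) (suc y) M =
  trans (removeAt-suc 𝟎 (punchIn k y ∶∶ M) k) (cong (𝟎 ∷_) (removeAt-∶∶-punchIn k y M))

lookup-∶∶-self : ∀ {n} (x : Fin n) M → lookup (x ∶∶ M) x ≡ M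
lookup-∶∶-self x M = lookup∘update x 𝟎Γ M

lookup-∶∶-other : ∀ {n} {x i : Fin n} M → i ≢ x → lookup (x ∶∶ M) i ≡ 𝟎
lookup-∶∶-other {i = i} M i≢x = trans (lookup∘update′ i≢x 𝟎Γ M) (lookup-replicate i 𝟎)

≈∶∶-split-self : ∀ {n} {Θ : TyCtx (suc n)} {k M} → Θ ≈Γ (k ∶∶ M) →
                 lookup Θ k ≈M M × removeAt Θ k ≈Γ 𝟎Γ
≈∶∶-split-self {k = k} {M} Θ≈ =
  Mul.trans (Pointwise.lookup Θ≈ k) (Mul.reflexive (lookup-∶∶-self k M)) ,
  Ctx.trans (removeAt-cong k Θ≈) (Ctx.reflexive (removeAt-∶∶ k M))

≈∶∶-split-punchIn : ∀ {n} {Θ : TyCtx (suc n)} {k y M} → Θ ≈Γ (punchIn k y ∶∶ M) →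
                    lookup Θ k ≈M 𝟎 × removeAt Θ k ≈Γ (y ∶∶ M)
≈∶∶-split-punchIn {k = k} {y} {M} Θ≈ =
  Mul.trans (Pointwise.lookup Θ≈ k) (Mul.reflexive (lookup-∶∶-other M (punchInᵢ≢i k y ∘ sym))) ,
  Ctx.trans (removeAt-cong k Θ≈) (Ctx.reflexive (removeAt-∶∶-punchIn k y M))

insertAt-cong : ∀ {n} {Γ Δ : TyCtx n} {M N} k → Γ ≈Γ Δ → M ≈M N → insertAt Γ k M ≈Γ insertAt Δ k N
insertAt-cong zero    Γ≈Δ          M≈N = M≈N ∷ Γ≈Δ
insertAt-cong (suc k) (L≈L′ ∷ Γ≈Δ) M≈N = L≈L′ ∷ insertAt-cong k Γ≈Δ M≈N

insertAt-⊎Γ : ∀ {n} (Γ Δ : TyCtx n) k M N → insertAt (Γ ⊎Γ Δ) k (M ⊎ N) ≡ insertAt Γ k M ⊎Γ insertAt Δ k N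
insertAt-⊎Γ Γ       Δ       zero    M N = refl
insertAt-⊎Γ (L ∷ Γ) (L′ ∷ Δ) (suc k) M N = cong (L ⊎ L′ ∷_) (insertAt-⊎Γ Γ Δ k M N)

insertAt-𝟎Γ : ∀ {n} (k : Fin (suc n)) → insertAt 𝟎Γ k 𝟎 ≡ 𝟎Γ
insertAt-𝟎Γ         zero    = refl
insertAt-𝟎Γ {suc n} (suc k) = cong (𝟎 ∷_) (insertAt-𝟎Γ k)

insertAt-∶∶ : ∀ {n} (x : Fin n) M k → insertAt (x ∶∶ M) k 𝟎 ≡ punchIn k x ∶∶ M
insertAt-∶∶         x       M zero    = refl
insertAt-∶∶ {suc n} zero    M (suc k) = cong (M ∷_) (insertAt-𝟎Γ k)
insertAt-∶∶ {suc n} (suc x) M (suc k) = cong (𝟎 ∷_) (insertAt-∶∶ x M k)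

⊢-resp-≈ : ∀ {n} {Θ Θ′ : TyCtx n} {t T T′} → Θ ≈Γ Θ′ → T ≈M T′ → (π : Θ ⊢ t ∶ T) →
           Σ (Θ′ ⊢ t ∶ T′) λ π′ → sizeD π′ ≡ sizeD π
⊢-resp-≈ Θ≈ T≈ (ax x M Θ≈x T≈M)  = ax x M (Ctx.trans (Ctx.sym Θ≈) Θ≈x) (Mul.trans (Mul.sym T≈) T≈M) , refl
⊢-resp-≈ Θ≈ T≈ (app π σ Θ≈ΓΔ T≈N) = app π σ (Ctx.trans (Ctx.sym Θ≈) Θ≈ΓΔ) (Mul.trans (Mul.sym T≈) T≈N) , refl
⊢-resp-≈ Θ≈ T≈ (lam ps Θ≈Γ T≈A)   = lam ps (Ctx.trans (Ctx.sym Θ≈) Θ≈Γ) (Mul.trans (Mul.sym T≈) T≈A) , refl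

size≤sizeD : ∀ {n} {Θ : TyCtx n} {t T} (π : Θ ⊢ t ∶ T) → size t ≤ sizeD π
size≤sizeD (ax _ _ _ _) = z≤n
size≤sizeD (lam _ _ _)  = z≤n
size≤sizeD {t = app t u} (app π σ _ _) =
  ≤-trans (≤-reflexive (+-comm (size t + size u) 1)) (s≤s (+-mono-≤ (size≤sizeD π) (size≤sizeD σ)))

sizeP≤sizePD : ∀ {n Γ k} {t : Term k} {E : Env n k} {M} (π : Γ ⊢P t , E ∶ M) → sizeP t E ≤ sizePD π
sizeP≤sizePD (es-ε π _ _)        = size≤sizeD π
sizeP≤sizePD (es-snoc π σ _ _ _) = +-mono-≤ (sizeP≤sizePD π) (size≤sizeD σ)

LamPremises-++ : ∀ {n} {t : Term (suc n)} {Γ} A₁ {A₂} (ps : LamPremises t Γ (A₁ ++ A₂)) →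
  Σ[ Γ₁ ∈ TyCtx n ] Σ[ Γ₂ ∈ TyCtx n ] Σ[ ps₁ ∈ LamPremises t Γ₁ A₁ ] Σ[ ps₂ ∈ LamPremises t Γ₂ A₂ ]
  Γ ≈Γ (Γ₁ ⊎Γ Γ₂) × sizeL ps₁ + sizeL ps₂ ≡ sizeL ps
LamPremises-++ []       ps = 𝟎Γ , _ , none , ps , Ctx.sym (Ctx.identityˡ _) , refl
LamPremises-++ (_ ∷ A₁) (more {Γ = Γ₀} π ps) with LamPremises-++ A₁ ps
... | Γ₁ , Γ₂ , ps₁ , ps₂ , Γ≈ , size≡ =
  Γ₀ ⊎Γ Γ₁ , Γ₂ , more π ps₁ , ps₂ ,
  Ctx.trans (Ctx.∙-congˡ Γ≈) (Ctx.sym (Ctx.assoc Γ₀ Γ₁ Γ₂)) ,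
  trans (+-assoc (sizeD π) (sizeL ps₁) (sizeL ps₂)) (cong (sizeD π +_) size≡)

LamPremises-insert : ∀ {n} {t : Term (suc n)} {M N B B′ Γ₀ Γ} → Del (M ⊸ N) B B′ →
  (π : (M ∷ Γ₀) ⊢ t ∶ N) (ps : LamPremises t Γ B′) →
  Σ[ Γ′ ∈ TyCtx n ] Σ[ ps′ ∈ LamPremises t Γ′ B ] Γ′ ≈Γ (Γ₀ ⊎Γ Γ) × sizeL ps′ ≡ sizeD π + sizeL ps
LamPremises-insert here π ps = _ , more π ps , Ctx.refl , refl
LamPremises-insert {Γ₀ = Γ₀} (there d) π (more {Γ = Γ₁} {Δ = Γ₂} π₁ ps) with LamPremises-insert d π ps
... | Γ′ , ps′ , Γ′≈ , size≡ =
  Γ₁ ⊎Γ Γ′ , more π₁ ps′ ,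
  Ctx.trans (Ctx.∙-congˡ Γ′≈) (Ctxᴾ.x∙yz≈y∙xz Γ₁ Γ₀ Γ₂) ,
  trans (cong (sizeD π₁ +_) size≡) (ℕᴾ.x∙yz≈y∙xz (sizeD π₁) (sizeD π) (sizeL ps))

LamPremises-resp-≈ : ∀ {n} {t : Term (suc n)} {Γ A B} (ps : LamPremises t Γ A) → A ≈M B →
  Σ[ Γ′ ∈ TyCtx n ] Σ[ ps′ ∈ LamPremises t Γ′ B ] Γ′ ≈Γ Γ × sizeL ps′ ≡ sizeL ps
LamPremises-resp-≈ none [] = _ , none , Ctx.refl , refl
LamPremises-resp-≈ (more {Γ = Γ₀} π ps) (⊸-cong M≈ N≈ ∷⟨ d ⟩ A≈)
  with LamPremises-resp-≈ ps A≈ | ⊢-resp-≈ (M≈ ∷ Ctx.refl {x = Γ₀}) N≈ π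
... | _ , ps′ , Γ′≈ , size≡ | π′ , size≡′ with LamPremises-insert d π′ ps′
...   | Γ″ , ps″ , Γ″≈ , size≡″ =
  Γ″ , ps″ , Ctx.trans Γ″≈ (Ctx.∙-congˡ Γ′≈) , trans size≡″ (cong₂ _+_ size≡′ size≡)

value-𝟎 : ∀ {n} {Δ : TyCtx n} {v T} → Value v → (δ : Δ ⊢ v ∶ T) → T ≈M 𝟎 → Δ ≈Γ 𝟎Γ × sizeD δ ≡ 0
value-𝟎 (v-var x) (ax .x M Δ≈ T≈M) T≈𝟎 with ≈M-[] (Mul.trans (Mul.sym T≈M) T≈𝟎)
... | refl = Ctx.trans Δ≈ (Ctx.reflexive (∶∶-𝟎 x)) , refl
value-𝟎 (v-lam t) (lam none Δ≈ _) _ = Δ≈ , refl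
value-𝟎 (v-lam t) (lam (more _ _) _ T≈A) T≈𝟎 with ≈M-[] (Mul.trans (Mul.sym T≈A) T≈𝟎)
... | ()

-- A value is typed by rule (ax) or (λ), both of which split along any decomposition of the type.
value-split : ∀ {n} {Δ : TyCtx n} {v T} M₁ M₂ → Value v → (δ : Δ ⊢ v ∶ T) → T ≈M (M₁ ⊎ M₂) →
  Σ[ Δ₁ ∈ TyCtx n ] Σ[ Δ₂ ∈ TyCtx n ] Σ[ δ₁ ∈ Δ₁ ⊢ v ∶ M₁ ] Σ[ δ₂ ∈ Δ₂ ⊢ v ∶ M₂ ]
  Δ ≈Γ (Δ₁ ⊎Γ Δ₂) × sizeD δ₁ + sizeD δ₂ ≤ sizeD δ
value-split M₁ M₂ (v-var x) (ax .x M Δ≈ T≈M) T≈ =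
  x ∶∶ M₁ , x ∶∶ M₂ , ax x M₁ Ctx.refl Mul.refl , ax x M₂ Ctx.refl Mul.refl ,
  Ctx.trans Δ≈ (Ctx.trans (∶∶-cong x (Mul.trans (Mul.sym T≈M) T≈)) (Ctx.sym (∶∶-⊎ x M₁ M₂))) , z≤n
value-split M₁ M₂ (v-lam t) (lam ps Δ≈ T≈A) T≈ with LamPremises-resp-≈ ps (Mul.trans (Mul.sym T≈A) T≈)
... | _ , ps′ , Γ′≈ , size≡ with LamPremises-++ M₁ ps′
...   | Γ₁ , Γ₂ , ps₁ , ps₂ , Γ≈ , size≡′ =
  Γ₁ , Γ₂ , lam ps₁ Ctx.refl Mul.refl , lam ps₂ Ctx.refl Mul.refl ,
  Ctx.trans Δ≈ (Ctx.trans (Ctx.sym Γ′≈) Γ≈) , ≤-reflexive (trans size≡′ size≡)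

ext-punchIn : ∀ {n} {k : Fin (suc n)} {ρ : Ren n (suc n)} → (∀ x → ρ x ≡ punchIn k x) →
              ∀ x → ext ρ x ≡ punchIn (suc k) x
ext-punchIn ρ≗ zero    = refl
ext-punchIn ρ≗ (suc x) = cong suc (ρ≗ x)

mutual
  ⊢-weaken : ∀ {n} k {ρ : Ren n (suc n)} → (∀ x → ρ x ≡ punchIn k x) →
             ∀ {Θ t T} (π : Θ ⊢ t ∶ T) →
             Σ (insertAt Θ k 𝟎 ⊢ rename ρ t ∶ T) λ π′ → sizeD π′ ≡ sizeD π
  ⊢-weaken k {ρ} ρ≗ (ax x M Θ≈ T≈) =
    ax (ρ x) M (Ctx.trans (insertAt-cong k Θ≈ Mul.refl) (Ctx.reflexive x∶∶M⁺)) T≈ , refl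
    where
    x∶∶M⁺ : insertAt (x ∶∶ M) k 𝟎 ≡ ρ x ∶∶ M
    x∶∶M⁺ = trans (insertAt-∶∶ x M k) (cong (_∶∶ M) (sym (ρ≗ x)))
  ⊢-weaken k ρ≗ (app {Γ = Γ} {Δ} π σ Θ≈ T≈) with ⊢-weaken k ρ≗ π | ⊢-weaken k ρ≗ σ
  ... | π′ , size≡ | σ′ , size≡′ =
    app π′ σ′ (Ctx.trans (insertAt-cong k Θ≈ Mul.refl) (Ctx.reflexive (insertAt-⊎Γ Γ Δ k 𝟎 𝟎))) T≈ ,
    cong suc (cong₂ _+_ size≡ size≡′)
  ⊢-weaken k ρ≗ (lam ps Θ≈ T≈) with LamPremises-weaken k ρ≗ ps
  ... | _ , ps′ , Γ′≈ , size≡ = lam ps′ (Ctx.trans (insertAt-cong k Θ≈ Mul.refl) (Ctx.sym Γ′≈)) T≈ , size≡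

  LamPremises-weaken : ∀ {n} k {ρ : Ren n (suc n)} → (∀ x → ρ x ≡ punchIn k x) →
    ∀ {t Γ A} (ps : LamPremises t Γ A) →
    Σ[ Γ′ ∈ TyCtx (suc n) ] Σ[ ps′ ∈ LamPremises (rename (ext ρ) t) Γ′ A ]
    Γ′ ≈Γ insertAt Γ k 𝟎 × sizeL ps′ ≡ sizeL ps
  LamPremises-weaken k ρ≗ none = _ , none , Ctx.reflexive (sym (insertAt-𝟎Γ k)) , refl
  LamPremises-weaken k ρ≗ (more {Γ = Γ₀} {Δ = Γ} π ps)
    with ⊢-weaken (suc k) (ext-punchIn ρ≗) π | LamPremises-weaken k ρ≗ ps
  ... | π′ , size≡ | _ , ps′ , Γ′≈ , size≡′ =
    _ , more π′ ps′ , Ctx.trans (Ctx.∙-congˡ Γ′≈) (Ctx.reflexive (sym (insertAt-⊎Γ Γ₀ Γ k 𝟎 𝟎))) ,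
    cong₂ _+_ size≡ size≡′

⊢-weaken-suc : ∀ {n} {Θ : TyCtx n} {t T} (π : Θ ⊢ t ∶ T) →
               Σ ((𝟎 ∷ Θ) ⊢ rename suc t ∶ T) λ π′ → sizeD π′ ≡ sizeD π
⊢-weaken-suc = ⊢-weaken zero (λ _ → refl)

record SingleSub {n} (k : Fin (suc n)) (v : Term n) (σ : Sub (suc n) n) : Set where
  field
    hit  : σ k ≡ v
    miss : ∀ y → σ (punchIn k y) ≡ var y

SingleSub-exts : ∀ {n} {k : Fin (suc n)} {v σ} → SingleSub k v σ → SingleSub (suc k) (rename suc v) (exts σ)
SingleSub-exts {k = k} {σ = σ} σ↦ = record { hit = cong (rename suc) (hit σ↦) ; miss = miss′ }
  where
  open SingleSub
  miss′ : ∀ y → exts σ (punchIn (suc k) y) ≡ var y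
  miss′ zero    = refl
  miss′ (suc y) = cong (rename suc) (miss σ↦ y)

Value-rename : ∀ {n m} (ρ : Ren n m) {v} → Value v → Value (rename ρ v)
Value-rename ρ (v-var x) = v-var (ρ x)
Value-rename ρ (v-lam t) = v-lam (rename (ext ρ) t)

data PunchInView {n} (k : Fin (suc n)) : Fin (suc n) → Set where
  self    : PunchInView k k
  punched : ∀ y → PunchInView k (punchIn k y)

punchInView : ∀ {n} (k x : Fin (suc n)) → PunchInView k x
punchInView k x with k ≟ x
... | yes refl = self
... | no k≢x   = substEq (PunchInView k) (punchIn-punchOut k≢x) (punched (punchOut k≢x))

≤-+-interchange : ∀ a b c d {a′ b′ e} → a′ ≤ a + c → b′ ≤ b + d → c + d ≤ e → a′ + b′ ≤ (a + b) + e
≤-+-interchange a b c d a′≤ b′≤ c+d≤ =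
  ≤-trans (+-mono-≤ a′≤ b′≤) (≤-trans (≤-reflexive (ℕᴾ.interchange a c b d)) (+-monoʳ-≤ (a + b) c+d≤))

lookup-⊎Γ : ∀ {n} {Θ Γ Δ : TyCtx n} k → Θ ≈Γ (Γ ⊎Γ Δ) → lookup Θ k ≈M (lookup Γ k ⊎ lookup Δ k)
lookup-⊎Γ {Γ = Γ} {Δ} k Θ≈ = Mul.trans (Pointwise.lookup Θ≈ k) (Mul.reflexive (lookup-zipWith _⊎_ k Γ Δ))

⊢-subst-var : ∀ {n} {k : Fin (suc n)} {σ v} → SingleSub k v σ → Value v →
  ∀ {Θ T M} x → Θ ≈Γ (x ∶∶ M) → T ≈M M → ∀ {Δ} (δ : Δ ⊢ v ∶ lookup Θ k) →
  Σ ((removeAt Θ k ⊎Γ Δ) ⊢ σ x ∶ T) λ π′ → sizeD π′ ≤ sizeD δ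
⊢-subst-var {k = k} σ↦ val x Θ≈ T≈ {Δ} δ with punchInView k x
... | self with ≈∶∶-split-self Θ≈
...   | Θk≈ , Θ-k≈ rewrite SingleSub.hit σ↦ =
  let δ′ , size≡ = ⊢-resp-≈ (Ctx.trans (Ctx.sym (Ctx.identityˡ Δ)) (Ctx.∙-congʳ (Ctx.sym Θ-k≈)))
                            (Mul.trans Θk≈ (Mul.sym T≈)) δ
  in δ′ , ≤-reflexive size≡
⊢-subst-var {k = k} σ↦ val {M = M} x Θ≈ T≈ δ | punched y with ≈∶∶-split-punchIn Θ≈
...   | Θk≈ , Θ-k≈ rewrite SingleSub.miss σ↦ y =
  ax y M (Ctx.trans (Ctx.∙-cong Θ-k≈ (proj₁ (value-𝟎 val δ Θk≈))) (Ctx.identityʳ _)) T≈ , z≤n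

mutual
  ⊢-subst : ∀ {n} {k : Fin (suc n)} {σ v} → SingleSub k v σ → Value v →
    ∀ {Θ t T} (π : Θ ⊢ t ∶ T) {Δ} (δ : Δ ⊢ v ∶ lookup Θ k) →
    Σ ((removeAt Θ k ⊎Γ Δ) ⊢ subst σ t ∶ T) λ π′ → sizeD π′ ≤ sizeD π + sizeD δ
  ⊢-subst σ↦ val (ax x M Θ≈ T≈) δ = ⊢-subst-var σ↦ val x Θ≈ T≈ δ
  ⊢-subst {k = k} σ↦ val (app {Γ = Γ₁} {Δ = Γ₂} π₁ π₂ Θ≈ T≈) δ
    with value-split (lookup Γ₁ k) (lookup Γ₂ k) val δ (lookup-⊎Γ k Θ≈)
  ... | Δ₁ , Δ₂ , δ₁ , δ₂ , Δ≈ , size≤ with ⊢-subst σ↦ val π₁ δ₁ | ⊢-subst σ↦ val π₂ δ₂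
  ...   | π₁′ , size≤₁ | π₂′ , size≤₂ =
    app π₁′ π₂′
      (Ctx.trans (Ctx.∙-cong (Ctx.trans (removeAt-cong k Θ≈) (Ctx.reflexive (removeAt-⊎Γ Γ₁ Γ₂ k))) Δ≈)
                 (Ctxᴾ.interchange (removeAt Γ₁ k) (removeAt Γ₂ k) Δ₁ Δ₂))
      T≈ ,
    s≤s (≤-+-interchange (sizeD π₁) (sizeD π₂) (sizeD δ₁) (sizeD δ₂) size≤₁ size≤₂ size≤)
  ⊢-subst {k = k} σ↦ val (lam ps Θ≈ T≈) δ
    with ⊢-resp-≈ Ctx.refl (Pointwise.lookup Θ≈ k) δ
  ... | δ′ , size≡ with LamPremises-subst σ↦ val ps δ′
  ...   | _ , ps′ , Γ′≈ , size≤ =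
    lam ps′ (Ctx.trans (Ctx.∙-congʳ (removeAt-cong k Θ≈)) (Ctx.sym Γ′≈)) T≈ ,
    ≤-trans size≤ (≤-reflexive (cong (sizeL ps +_) size≡))

  LamPremises-subst : ∀ {n} {k : Fin (suc n)} {σ v} → SingleSub k v σ → Value v →
    ∀ {t Γ A} (ps : LamPremises t Γ A) {Δ} (δ : Δ ⊢ v ∶ lookup Γ k) →
    Σ[ Γ′ ∈ TyCtx n ] Σ[ ps′ ∈ LamPremises (subst (exts σ) t) Γ′ A ]
    Γ′ ≈Γ (removeAt Γ k ⊎Γ Δ) × sizeL ps′ ≤ sizeL ps + sizeD δ
  LamPremises-subst {k = k} σ↦ val none δ =
    let Δ≈ , _ = value-𝟎 val δ (Mul.reflexive (lookup-replicate k 𝟎))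
    in 𝟎Γ , none ,
       Ctx.sym (Ctx.trans (Ctx.∙-cong (Ctx.reflexive (removeAt-𝟎Γ k)) Δ≈) (Ctx.identityˡ 𝟎Γ)) ,
       z≤n
  LamPremises-subst {k = k} σ↦ val (more {Γ = Γ₁} {M} {Δ = Γ₂} π ps) δ
    with value-split (lookup Γ₁ k) (lookup Γ₂ k) val δ (Mul.reflexive (lookup-zipWith _⊎_ k Γ₁ Γ₂))
  ... | Δ₁ , Δ₂ , δ₁ , δ₂ , Δ≈ , size≤ with ⊢-weaken-suc δ₁ | LamPremises-subst σ↦ val ps δ₂
  ...   | δ₁′ , size≡ | Γ′ , ps′ , Γ′≈ , size≤′
    with ⊢-subst (SingleSub-exts σ↦) (Value-rename suc val) π δ₁′
  ...     | π′ , size≤″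
    with ⊢-resp-≈ (Ctx.trans (Ctx.∙-congʳ (Ctx.reflexive (removeAt-suc M Γ₁ k))) (Mul.identityʳ M ∷ Ctx.refl)) Mul.refl π′
  ...       | π″ , size≡′ =
    _ , more π″ ps′ ,
    Ctx.trans (Ctx.∙-congˡ Γ′≈)
      (Ctx.trans (Ctxᴾ.interchange (removeAt Γ₁ k) Δ₁ (removeAt Γ₂ k) Δ₂)
        (Ctx.∙-cong (Ctx.reflexive (sym (removeAt-⊎Γ Γ₁ Γ₂ k))) (Ctx.sym Δ≈))) ,
    ≤-+-interchange (sizeD π) (sizeL ps) (sizeD δ₁) (sizeD δ₂)
      (≤-trans (≤-reflexive size≡′) (≤-trans size≤″ (≤-reflexive (cong (sizeD π +_) size≡))))
      size≤′ size≤

-- The premises of rule (es@) for the program (s , [x ← u]).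
record LetTyping {n} (Θ : TyCtx n) (s : Term (suc n)) (u : Term n) (T : MType) : Set where
  field
    {M}   : MType
    {Γ Δ} : TyCtx n
    body  : (M ∷ Γ) ⊢ s ∶ T
    arg   : Δ ⊢ u ∶ M
    split : Θ ≈Γ (Γ ⊎Γ Δ)

open LetTyping using (body; arg; split)

sizeLet : ∀ {n} {Θ : TyCtx n} {s u T} → LetTyping Θ s u T → ℕ
sizeLet ℓ = sizeD (body ℓ) + sizeD (arg ℓ)

⊢-redex⁻¹ : ∀ {n} {Θ : TyCtx n} {t u T} (π : Θ ⊢ app (lam t) u ∶ T) →
            Σ (LetTyping Θ t u T) λ ℓ → suc (sizeLet ℓ) ≡ sizeD π
⊢-redex⁻¹ (app {Δ = Δ} (lam (more {Γ = Γ} π none) Γ′≈ (⊸-cong M≈ N≈ ∷⟨ here ⟩ [])) σ Θ≈ T≈)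
  with ⊢-resp-≈ Ctx.refl (Mul.sym (Mul.trans T≈ N≈)) π | ⊢-resp-≈ Ctx.refl M≈ σ
... | π′ , size≡ | σ′ , size≡′ =
  record { body = π′ ; arg = σ′ ; split = Ctx.trans Θ≈ (Ctx.∙-congʳ (Ctx.trans Γ′≈ (Ctx.identityʳ Γ))) } ,
  cong suc (cong₂ _+_ (trans size≡ (sym (+-identityʳ _))) size≡′)

Shrinks : ∀ {n} → Term n → Term n → Set
Shrinks {n} r r′ = ∀ {Θ : TyCtx n} {T} (π : Θ ⊢ r ∶ T) → Σ (Θ ⊢ r′ ∶ T) λ π′ → sizeD π′ < sizeD π

⊢-βv : ∀ {n} {t : Term (suc n)} {v} → Value v → Shrinks (app (lam t) v) (t [ v ])
⊢-βv val π with ⊢-redex⁻¹ π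
... | ℓ , size≡ with ⊢-subst (record { hit = refl ; miss = λ _ → refl }) val (body ℓ) (arg ℓ)
...   | π′ , size≤ with ⊢-resp-≈ (Ctx.sym (split ℓ)) Mul.refl π′
...     | π″ , size≡′ = π″ , ≤-trans (s≤s (≤-trans (≤-reflexive size≡′) size≤)) (≤-reflexive size≡)

Shrinks-plug : ∀ {n} (C : ECtx n) {r r′} → Shrinks r r′ → Shrinks (plug C r) (plug C r′)
Shrinks-plug hole       r↝r′ π = r↝r′ π
Shrinks-plug (appR u C) r↝r′ (app π₁ π₂ Θ≈ T≈) with Shrinks-plug C r↝r′ π₂
... | π₂′ , size< = app π₁ π₂′ Θ≈ T≈ , s≤s (+-monoʳ-< (sizeD π₁) size<)
Shrinks-plug (appL C u) r↝r′ (app π₁ π₂ Θ≈ T≈) with Shrinks-plug C r↝r′ π₁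
... | π₁′ , size< = app π₁′ π₂ Θ≈ T≈ , s≤s (+-monoˡ-< (sizeD π₂) size<)

⊢-βi-plug : ∀ {n} (C : ECtx n) {t : Term (suc n)} {i Θ T} (π : Θ ⊢ plug C (app (lam t) i) ∶ T) →
            Σ (LetTyping Θ (plug (wkCtx C) t) i T) λ ℓ → sizeLet ℓ < sizeD π
⊢-βi-plug hole π = let ℓ , size≡ = ⊢-redex⁻¹ π in ℓ , ≤-reflexive size≡
⊢-βi-plug (appR u C) (app {Γ = Γ₁} π₁ π₂ Θ≈ T≈) with ⊢-βi-plug C π₂ | ⊢-weaken-suc π₁
... | ℓ , size< | π₁′ , size≡ =
  record { body  = app π₁′ (body ℓ) Ctx.refl T≈
         ; arg   = arg ℓ
         ; split = Ctx.trans Θ≈ (Ctx.trans (Ctx.∙-congˡ (split ℓ)) (Ctx.sym (Ctx.assoc Γ₁ _ _))) } ,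
  s≤s (begin
    suc (sizeD π₁′ + sizeD (body ℓ)) + sizeD (arg ℓ) ≡⟨ cong suc (+-assoc (sizeD π₁′) _ _) ⟩
    suc (sizeD π₁′ + sizeLet ℓ)                       ≡⟨ sym (+-suc (sizeD π₁′) (sizeLet ℓ)) ⟩
    sizeD π₁′ + suc (sizeLet ℓ)                       ≤⟨ +-mono-≤ (≤-reflexive size≡) size< ⟩
    sizeD π₁ + sizeD π₂                               ∎)
  where open ≤-Reasoning
⊢-βi-plug (appL C u) (app {Δ = Γ₂} π₁ π₂ Θ≈ T≈) with ⊢-βi-plug C π₁ | ⊢-weaken-suc π₂
... | ℓ , size< | π₂′ , size≡ =
  record { body  = app (body ℓ) π₂′ (Mul.sym (Mul.identityʳ _) ∷ Ctx.refl) T≈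
         ; arg   = arg ℓ
         ; split = Ctx.trans Θ≈ (Ctx.trans (Ctx.∙-congʳ (split ℓ)) (Ctxᴾ.xy∙z≈xz∙y _ _ Γ₂)) } ,
  s≤s (begin
    suc (sizeD (body ℓ) + sizeD π₂′) + sizeD (arg ℓ) ≡⟨ cong suc (ℕᴾ.xy∙z≈xz∙y (sizeD (body ℓ)) _ _) ⟩
    suc (sizeLet ℓ + sizeD π₂′)                       ≤⟨ +-mono-≤ size< (≤-reflexive size≡) ⟩
    sizeD π₁ + sizeD π₂                               ∎)
  where open ≤-Reasoning

⊢P-shrink : ∀ {n k} {r r′ : Term k} → Shrinks r r′ → ∀ {E : Env n k} {Θ T} (π : Θ ⊢P r , E ∶ T) →
            Σ (Θ ⊢P r′ , E ∶ T) λ π′ → sizePD π′ < sizePD π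
⊢P-shrink r↝r′ (es-ε π Θ≈ T≈) with r↝r′ π
... | π′ , size< = es-ε π′ Θ≈ T≈ , size<
⊢P-shrink r↝r′ (es-snoc π σ ii Θ≈ T≈) with ⊢P-shrink r↝r′ π
... | π′ , size< = es-snoc π′ σ ii Θ≈ T≈ , +-monoˡ-< (sizeD σ) size<

⊢P-βi : ∀ {n k} {C : ECtx k} {t i} (ii : Inert i) {E : Env n k} {Θ T}
        (π : Θ ⊢P plug C (app (lam t) i) , E ∶ T) →
        Σ (Θ ⊢P plug (wkCtx C) t , (i ∷ₑ E ∣ ii) ∶ T) λ π′ → sizePD π′ < sizePD π
⊢P-βi {C = C} ii (es-ε π Θ≈ T≈) with ⊢-βi-plug C π
... | ℓ , size< = es-snoc (es-ε (body ℓ) Ctx.refl Mul.refl) (arg ℓ) ii (Ctx.trans Θ≈ (split ℓ)) T≈ , size<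
⊢P-βi ii (es-snoc π σ jj Θ≈ T≈) with ⊢P-βi ii π
... | π′ , size< = es-snoc π′ σ jj Θ≈ T≈ , +-monoˡ-< (sizeD σ) size<

subject-reduction : ∀ {n} {p q : Prog n} → p ⟶βf q → ∀ {Γ M} (π : Γ ⊢Prog p ∶ M) →
                    Σ (Γ ⊢Prog q ∶ M) λ π′ → sizeProgD {p = q} π′ < sizeProgD {p = p} π
subject-reduction (βv {C = C} _ val) = ⊢P-shrink (Shrinks-plug C (⊢-βv val))
subject-reduction (βi _ ii)          = ⊢P-βi ii

data FireballOrRedex {n} : Term n → Set where
  fireball : ∀ {t} → Fireball t → FireballOrRedex t
  redex    : ∀ {C : ECtx n} {s a} → IsRCtx C → Value a ⊎ˢ Inert a → FireballOrRedex (plug C (app (lam s) a))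

Fireball⇒Value⊎Inert : ∀ {n} {a : Term n} → Fireball a → Value a ⊎ˢ Inert a
Fireball⇒Value⊎Inert (f-val v)   = inj₁ v
Fireball⇒Value⊎Inert (f-inert i) = inj₂ i

fireballOrRedex : ∀ {n} (t : Term n) → FireballOrRedex t
fireballOrRedex (var x) = fireball (f-val (v-var x))
fireballOrRedex (lam t) = fireball (f-val (v-lam t))
fireballOrRedex (app t u) with fireballOrRedex u
... | redex C a = redex (rc-appR t C) a
... | fireball fu with fireballOrRedex t
...   | redex C a                  = redex (rc-appL C fu) a
...   | fireball (f-val (v-var x)) = fireball (f-inert (i-var x fu))
...   | fireball (f-val (v-lam s)) = redex rc-hole (Fireball⇒Value⊎Inert fu)
...   | fireball (f-inert i)       = fireball (f-inert (i-app i fu))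

mutual
  plug-redex-¬Inert : ∀ {n} {C : ECtx n} {s a} → IsRCtx C → ¬ Inert (plug C (app (lam s) a))
  plug-redex-¬Inert rc-hole                     (i-app () _)
  plug-redex-¬Inert (rc-appR _ C)               (i-var _ f) = plug-redex-¬Fireball C f
  plug-redex-¬Inert (rc-appR _ C)               (i-app _ f) = plug-redex-¬Fireball C f
  plug-redex-¬Inert (rc-appL C@rc-hole       _) (i-app i _) = plug-redex-¬Inert C i
  plug-redex-¬Inert (rc-appL C@(rc-appR _ _) _) (i-app i _) = plug-redex-¬Inert C i
  plug-redex-¬Inert (rc-appL C@(rc-appL _ _) _) (i-app i _) = plug-redex-¬Inert C i

  plug-redex-¬Fireball : ∀ {n} {C : ECtx n} {s a} → IsRCtx C → ¬ Fireball (plug C (app (lam s) a))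
  plug-redex-¬Fireball C             (f-inert i) = plug-redex-¬Inert C i
  plug-redex-¬Fireball rc-hole       (f-val ())
  plug-redex-¬Fireball (rc-appR _ _) (f-val ())
  plug-redex-¬Fireball (rc-appL _ _) (f-val ())

Fireball⇒Normal : ∀ {m n} {t : Term n} {E : Env m n} → Fireball t → Normal ⟨ t , E ⟩
Fireball⇒Normal f (_ , βv C _) = plug-redex-¬Fireball C f
Fireball⇒Normal f (_ , βi C _) = plug-redex-¬Fireball C f

NormalisesWithin : ∀ {n} → Prog n → ℕ → Set
NormalisesWithin {n} p b = Σ (Prog n) λ q → Normal q × Σ (p ⟶* q) λ d → len d + sizeProg q ≤ b

-- The fuel only makes the recursion on |π| structural.
mutual
  normalise : ∀ fuel {n} (p : Prog n) {Γ M} (π : Γ ⊢Prog p ∶ M) →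
              sizeProgD {p = p} π ≤ fuel → NormalisesWithin p (sizeProgD {p = p} π)
  normalise fuel ⟨ t , E ⟩ π π≤ with fireballOrRedex t
  ... | fireball f         = ⟨ t , E ⟩ , Fireball⇒Normal f , done , sizeP≤sizePD π
  ... | redex C (inj₁ val) = normalise-after fuel (βv C val) π π≤
  ... | redex C (inj₂ ii)  = normalise-after fuel (βi C ii) π π≤

  normalise-after : ∀ fuel {n} {p q : Prog n} → p ⟶βf q → ∀ {Γ M} (π : Γ ⊢Prog p ∶ M) →
                    sizeProgD {p = p} π ≤ fuel → NormalisesWithin p (sizeProgD {p = p} π)
  normalise-after fuel {q = q} s π π≤ with subject-reduction s π
  ... | π′ , π′< with fuel | ≤-trans π′< π≤
  ...   | suc fuel′ | s≤s π′≤ with normalise fuel′ q π′ π′≤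
  ...     | r , r-normal , d , d≤ = r , r-normal , step s d , ≤-trans (s≤s d≤) π′<

theorem2 : ∀ {n} (p : Prog n) (Γ : TyCtx n) (M : MType) (π : Γ ⊢Prog p ∶ M) →
    Σ (Prog n) λ q → Normal q × Σ (p ⟶* q) λ d → len d + sizeProg q ≤ sizeProgD π
theorem2 p Γ M π = normalise (sizeProgD {p = p} π) p π ≤-refl
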